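{- For every integer $n\ge 0$, \[ \tilde{w}_{n}=\sum_{r=0}^{n}\frac{(-1)^{r}}{r!}\,{}_{r}w_{n},\qquad\text{where } {}_{r}w_{n}=\sum_{k=r}^{n}{n\brace k}k!. \]
   Context: ${n\brace k}$ denotes the Stirling number of the second kind; $d_k=k!\sum_{i=0}^k(-1)^i/i!$ is the number of derangements of a $k$-set. The deranged Bell numbers are $\tilde{w}_n=\sum_{k=0}^n{n\brace k}d_k$ (the number of set partitions of $[n]$ together with a fixed-point-free permutation of their blocks). -}

module Defs where

open import Data.Nat as ℕ using (ℕ; zero; suc; _!)
open import Data.Nat.Properties using (_!≢0)
open import Data.Integer as ℤ using (ℤ)
open import Data.Rational as ℚ using (ℚ; _/_)

sumFromTo : ℕ → ℕ → (ℕ → ℚ) → ℚ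
sumFromTo a b f = go (suc b ℕ.∸ a) a
  where
  go : ℕ → ℕ → ℚ
  go zero    i = ℚ.0ℚ
  go (suc m) i = f i ℚ.+ go m (suc i)

stirling2 : ℕ → ℕ → ℕ
stirling2 zero    zero    = 1
stirling2 zero    (suc k) = 0
stirling2 (suc n) zero    = 0
stirling2 (suc n) (suc k) = suc k ℕ.* stirling2 n (suc k) ℕ.+ stirling2 n k

ℕtoℚ : ℕ → ℚ
ℕtoℚ n = ℤ.+ n / 1

sgn : ℕ → ℚ
sgn zero    = ℚ.1ℚ
sgn (suc i) = ℚ.- sgn i

invFact : ℕ → ℚ
invFact i = (ℤ.+ 1 / (i !)) {{i !≢0}}

derange : ℕ → ℚ
derange k = ℕtoℚ (k !) ℚ.* sumFromTo 0 k (λ i → sgn i ℚ.* invFact i)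

derangedBell : ℕ → ℚ
derangedBell n = sumFromTo 0 n (λ k → ℕtoℚ (stirling2 n k) ℚ.* derange k)

rw : ℕ → ℕ → ℚ
rw r n = sumFromTo r n (λ k → ℕtoℚ (stirling2 n k ℕ.* k !))

{-# OPTIONS --safe #-}
-- Expanding d_k = k! Σ_{i ≤ k} (-1)^i / i!, the deranged Bell number becomes the double sum
-- Σ_{0 ≤ i ≤ k ≤ n} S(n,k) k! (-1)^i / i!; summing over k first for each fixed i yields
-- Σ_r (-1)^r / r! · _r w_n. Nothing about Stirling numbers or factorials is used beyond this
-- exchange of summation over a triangle, which holds in any commutative semiring.
module Submission where

open import Algebra.Bundles using (CommutativeSemiring; CommutativeRing)
open import Data.Nat using (ℕ; zero; suc; _∸_; _≤_; _<_; z<s; s≤s; _!)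
import Data.Nat as ℕ
import Data.Nat.Properties as ℕ
import Relation.Binary.PropositionalEquality as ≡

module RangeSum {c ℓ} (R : CommutativeSemiring c ℓ) where

  open CommutativeSemiring R hiding (zero)
  open import Algebra.Properties.CommutativeSemigroup +-commutativeSemigroup using (interchange)
  open import Relation.Binary.Reasoning.Setoid setoid

  ∑from : ℕ → ℕ → (ℕ → Carrier) → Carrier
  ∑from i zero    f = 0#
  ∑from i (suc m) f = f i + ∑from (suc i) m f

  ∑from-unique : ∀ {f} (G : ℕ → ℕ → Carrier) →
                 (∀ i → G zero i ≈ 0#) → (∀ m i → G (suc m) i ≈ f i + G m (suc i)) →
                 ∀ m i → G m i ≈ ∑from i m f
  ∑from-unique G G-zero G-suc zero    i = G-zero i
  ∑from-unique G G-zero G-suc (suc m) i =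
    trans (G-suc m i) (+-congˡ (∑from-unique G G-zero G-suc m (suc i)))

  ∑from-cong : ∀ {f h} i m → (∀ j → j < i ℕ.+ m → f j ≈ h j) → ∑from i m f ≈ ∑from i m h
  ∑from-cong i zero    f≈h = refl
  ∑from-cong {f} {h} i (suc m) f≈h = +-cong (f≈h i (ℕ.m<m+n i z<s)) (∑from-cong (suc i) m f≈h′)
    where
    f≈h′ : ∀ j → j < suc i ℕ.+ m → f j ≈ h j
    f≈h′ j j<i+1+m = f≈h j (≡.subst (j <_) (≡.sym (ℕ.+-suc i m)) j<i+1+m)

  ∑from-snoc : ∀ f i m → ∑from i (suc m) f ≈ ∑from i m f + f (i ℕ.+ m)
  ∑from-snoc f i zero = begin
    f i + 0#         ≈⟨ +-identityʳ (f i) ⟩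
    f i              ≡⟨ ≡.cong f (≡.sym (ℕ.+-identityʳ i)) ⟩
    f (i ℕ.+ 0)      ≈⟨ +-identityˡ _ ⟨
    0# + f (i ℕ.+ 0) ∎
  ∑from-snoc f i (suc m) = begin
    f i + ∑from (suc i) (suc m) f                  ≈⟨ +-congˡ (∑from-snoc f (suc i) m) ⟩
    f i + (∑from (suc i) m f + f (suc i ℕ.+ m))    ≈⟨ +-assoc _ _ _ ⟨
    f i + ∑from (suc i) m f + f (suc i ℕ.+ m)      ≡⟨ ≡.cong (λ j → f i + ∑from (suc i) m f + f j) (≡.sym (ℕ.+-suc i m)) ⟩
    f i + ∑from (suc i) m f + f (i ℕ.+ suc m)      ∎

  ∑from-∸-snoc : ∀ f {i n} → i ≤ n → ∑from i (suc n ∸ i) f ≈ ∑from i (n ∸ i) f + f n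
  ∑from-∸-snoc f {i} {n} i≤n = begin
    ∑from i (suc n ∸ i) f                   ≡⟨ ≡.cong (λ m → ∑from i m f) (ℕ.+-∸-assoc 1 i≤n) ⟩
    ∑from i (suc (n ∸ i)) f                 ≈⟨ ∑from-snoc f i (n ∸ i) ⟩
    ∑from i (n ∸ i) f + f (i ℕ.+ (n ∸ i))   ≡⟨ ≡.cong (λ j → ∑from i (n ∸ i) f + f j) (ℕ.m+[n∸m]≡n i≤n) ⟩
    ∑from i (n ∸ i) f + f n                 ∎

  ∑from-distrib-+ : ∀ f h i m → ∑from i m (λ j → f j + h j) ≈ ∑from i m f + ∑from i m h
  ∑from-distrib-+ f h i zero    = sym (+-identityʳ 0#)
  ∑from-distrib-+ f h i (suc m) =
    trans (+-congˡ (∑from-distrib-+ f h (suc i) m)) (interchange (f i) (h i) _ _)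

  *-distribʳ-∑from : ∀ f x i m → ∑from i m f * x ≈ ∑from i m (λ j → f j * x)
  *-distribʳ-∑from f x i zero    = zeroˡ x
  *-distribʳ-∑from f x i (suc m) = trans (distribʳ x (f i) _) (+-congˡ (*-distribʳ-∑from f x (suc i) m))

  ∑from-comm-triangle : ∀ a g n →
    ∑from 0 n (λ k → a k * ∑from 0 (suc k) g) ≈ ∑from 0 n (λ r → g r * ∑from r (n ∸ r) a)
  ∑from-comm-triangle a g zero    = refl
  ∑from-comm-triangle a g (suc n) = begin
    ∑from 0 (suc n) L                                     ≈⟨ ∑from-snoc L 0 n ⟩
    ∑from 0 n L + a n * G                                 ≈⟨ +-congʳ (∑from-comm-triangle a g n) ⟩
    ∑from 0 n Rₙ + a n * G                                ≈⟨ +-cong (+-identityʳ _) (*-comm G (a n)) ⟨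
    ∑from 0 n Rₙ + 0# + G * a n                           ≈⟨ +-congʳ (+-congˡ Rₙ-last) ⟨
    ∑from 0 n Rₙ + Rₙ n + G * a n                         ≈⟨ +-cong (sym (∑from-snoc Rₙ 0 n)) (*-distribʳ-∑from g (a n) 0 (suc n)) ⟩
    ∑from 0 (suc n) Rₙ + ∑from 0 (suc n) (λ r → g r * a n) ≈⟨ ∑from-distrib-+ Rₙ _ 0 (suc n) ⟨
    ∑from 0 (suc n) (λ r → Rₙ r + g r * a n)              ≈⟨ ∑from-cong 0 (suc n) extend ⟩
    ∑from 0 (suc n) (λ r → g r * ∑from r (suc n ∸ r) a)   ∎
    where
    L : ℕ → Carrier
    L k = a k * ∑from 0 (suc k) g
    Rₙ : ℕ → Carrier
    Rₙ r = g r * ∑from r (n ∸ r) a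
    G : Carrier
    G = ∑from 0 (suc n) g
    Rₙ-last : Rₙ n ≈ 0#
    Rₙ-last = trans (*-congˡ (reflexive (≡.cong (λ m → ∑from n m a) (ℕ.n∸n≡0 n)))) (zeroʳ (g n))
    extend : ∀ r → r < suc n → Rₙ r + g r * a n ≈ g r * ∑from r (suc n ∸ r) a
    extend r (s≤s r≤n) = trans (sym (distribˡ (g r) _ _)) (*-congˡ (sym (∑from-∸-snoc a r≤n)))

import Data.Integer as ℤ
import Data.Integer.Properties as ℤ
import Data.Nat.Coprimality as Coprime
open import Data.Rational using (ℚ; mkℚ; _/_; _+_; _*_)
import Data.Rational.Properties as ℚ
open import Relation.Binary.PropositionalEquality using (_≡_; refl; sym; cong; cong₂)
open ≡.≡-Reasoning
open import Defs

open RangeSum (CommutativeRing.commutativeSemiring ℚ.+-*-commutativeRing)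
  using (∑from; ∑from-unique; ∑from-cong; ∑from-comm-triangle)

-- The loop `go` local to sumFromTo is out of scope, so sumFromTo-loop is left to unification,
-- which solves it to that loop; abstracting `suc a` makes the unification problem a pattern.
mutual
  sumFromTo-loop : ℕ → ℕ → (ℕ → ℚ) → ℕ → ℕ → ℚ
  sumFromTo-loop = _

  sumFromTo-∑from : ∀ a b f → sumFromTo a b f ≡ ∑from a (suc b ∸ a) f
  sumFromTo-∑from a b f with suc b ∸ a
  ... | zero  = refl
  ... | suc m with suc a
  ...   | i = cong (f a +_) (∑from-unique (sumFromTo-loop a b f) (λ _ → refl) (λ _ _ → refl) m i)

ℕtoℚ-mkℚ : ∀ n → ℕtoℚ n ≡ mkℚ (ℤ.+ n) 0 (Coprime.sym (Coprime.1-coprimeTo n))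
ℕtoℚ-mkℚ n = ℚ.normalize-coprime _

-- ℚ multiplication of two numerals in normal form mkℚ (ℤ.+ k) 0 _ computes to (ℤ.+ m ℤ.* ℤ.+ n) / 1.
ℕtoℚ-* : ∀ m n → ℕtoℚ (m ℕ.* n) ≡ ℕtoℚ m * ℕtoℚ n
ℕtoℚ-* m n = begin
  ℤ.+ (m ℕ.* n) / 1                   ≡⟨ cong (_/ 1) (ℤ.pos-* m n) ⟩
  (ℤ.+ m ℤ.* ℤ.+ n) / 1               ≡⟨ sym (cong₂ _*_ (ℕtoℚ-mkℚ m) (ℕtoℚ-mkℚ n)) ⟩
  ℕtoℚ m * ℕtoℚ n                     ∎

mainTheorem3 : (n : ℕ) →
    derangedBell n ≡ sumFromTo 0 n (λ r → (sgn r * invFact r) * rw r n)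
mainTheorem3 n = begin
  derangedBell n                                            ≡⟨ sumFromTo-∑from 0 n (λ k → ℕtoℚ (stirling2 n k) * derange k) ⟩
  ∑from 0 (suc n) (λ k → ℕtoℚ (stirling2 n k) * derange k) ≡⟨ ∑from-cong 0 (suc n) (λ k _ → expand k) ⟩
  ∑from 0 (suc n) (λ k → a k * ∑from 0 (suc k) g)           ≡⟨ ∑from-comm-triangle a g (suc n) ⟩
  ∑from 0 (suc n) (λ r → g r * ∑from r (suc n ∸ r) a)       ≡⟨ ∑from-cong 0 (suc n) (λ r _ → cong (g r *_) (sym (sumFromTo-∑from r n a))) ⟩
  ∑from 0 (suc n) (λ r → g r * rw r n)                      ≡⟨ sym (sumFromTo-∑from 0 n (λ r → g r * rw r n)) ⟩
  sumFromTo 0 n (λ r → (sgn r * invFact r) * rw r n)        ∎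
  where
  a g : ℕ → ℚ
  a k = ℕtoℚ (stirling2 n k ℕ.* k !)
  g i = sgn i * invFact i
  expand : ∀ k → ℕtoℚ (stirling2 n k) * derange k ≡ a k * ∑from 0 (suc k) g
  expand k = begin
    ℕtoℚ (stirling2 n k) * (ℕtoℚ (k !) * sumFromTo 0 k g) ≡⟨ sym (ℚ.*-assoc (ℕtoℚ (stirling2 n k)) (ℕtoℚ (k !)) (sumFromTo 0 k g)) ⟩
    ℕtoℚ (stirling2 n k) * ℕtoℚ (k !) * sumFromTo 0 k g   ≡⟨ cong₂ _*_ (sym (ℕtoℚ-* (stirling2 n k) (k !))) (sumFromTo-∑from 0 k g) ⟩
    a k * ∑from 0 (suc k) g                               ∎
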